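{- Let $k\ge 1$ and $0\le t\le k$ be integers. For every integer $n\ge 1$, \begin{align*} [x^n]\,\partial_u^2 S_t(x,u)\Big|_{u=1}&=\frac{2(t+1)}{n+2}\binom{(k+1)(n+2)+t}{n+1}+\frac{(t+1)^2(t+2)}{n}\binom{(k+1)n+t}{n-1}\\ &\quad-\frac{2(t+k+2)(t+1)}{n+1}\binom{(k+1)(n+1)+t}{n}. \end{align*}
   Context: A $k_t$-Dyck path is a lattice path consisting of up-steps $(1,k)$ and down-steps $(1,-1)$ that starts at $(0,0)$, stays weakly above the line $y=-t$, and ends on the line $y=0$. $S_t(x,u)=\sum_P x^{\mathrm{up}(P)}u^{e(P)}$, summed over all $k_t$-Dyck paths $P$, where $\mathrm{up}(P)$ is the number of up-steps of $P$ and $e(P)$ is the number of down-steps after the last up-step of $P$ ($e=0$ for the empty path). $[x^n]$ denotes coefficient extraction. -}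

module Defs where

open import Data.Nat using (ℕ; zero; suc; _+_; _*_; _∸_)
open import Data.Integer as ℤ using (ℤ; +_; -_)
open import Data.Bool using (Bool; true; false; _∧_; if_then_else_)
open import Data.List using (List; []; _∷_; map; concatMap; filter; reverse)
open import Data.Nat.ListAction using (sum)
open import Relation.Nullary.Decidable using (⌊_⌋)
open import Data.Bool.Properties using (T?)

-- A step of a k_t-Dyck path: U = up-step (1,k), D = down-step (1,-1).
data Step : Set where
  U D : Step

words : ℕ → List (List Step)
words zero    = [] ∷ []
words (suc m) = concatMap (λ w → (U ∷ w) ∷ (D ∷ w) ∷ []) (words m)

ups : List Step → ℕ
ups []      = 0
ups (U ∷ w) = suc (ups w)
ups (D ∷ w) = ups w

validFrom : ℕ → ℕ → ℤ → List Step → Bool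
validFrom k t h []      = ⌊ h ℤ.≟ + 0 ⌋
validFrom k t h (U ∷ w) = validFrom k t (h ℤ.+ + k) w
validFrom k t h (D ∷ w) = ⌊ - (+ t) ℤ.≤? (h ℤ.- + 1) ⌋ ∧ validFrom k t (h ℤ.- + 1) w

-- A k_t-Dyck path with n up-steps: a word starting at (0,0) that is valid
-- and has exactly n up-steps.  Such a path has (k+1)n steps in total
-- (n ups and kn downs, since it ends at height 0).
isPath : ℕ → ℕ → ℕ → List Step → Bool
isPath k t n w = validFrom k t (+ 0) w ∧ ⌊ ups w Data.Nat.≟ n ⌋

paths : ℕ → ℕ → ℕ → List (List Step)
paths k t n = filter (λ w → T? (isPath k t n w)) (words ((k + 1) * n))

trailingDs : List Step → ℕ
trailingDs []      = 0
trailingDs (U ∷ _) = 0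
trailingDs (D ∷ w) = suc (trailingDs w)

e : List Step → ℕ
e w = trailingDs (reverse w)

-- [x^n] ∂_u^2 S_t(x,u) |_{u=1}  =  Σ_{P : up(P) = n} e(P)(e(P)-1).
coeffD2 : ℕ → ℕ → ℕ → ℕ
coeffD2 k t n = sum (map (λ w → e w * (e w ∸ 1)) (paths k t n))

module Submission where

-- Reading a path from the left and recording, at each moment,
-- its "room" r (its height above the line y = −t − 1), a path is a walk whose up-steps
-- add k to r, whose down-steps subtract 1, and which must keep r ≥ 1.  After the last
-- up-step the remaining down-steps are forced, so e(P) = r − (t + 1) for the room r right
-- after the last up-step.  Hence the coefficient is G ψ n (t + 1), where G ψ n r sums ψ
-- over the rooms reached after performing n further up-steps from room r (module Walks),
-- for ψ r = (r − t − 1)(r − t − 2); the count of such walks is count n r = G 1 n r.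
--
-- On r > t the
-- weight satisfies ψ r + 2(k + t + 2)·count 1 r = 2·count 2 r + (t + 1)(t + 2), giving the
-- linear relation  G ψ n s + 2(k+t+2) F(n+1) = 2 F(n+2) + (t+1)(t+2) F(n)  between the
-- counts F(m) = count m (t+1), s = t + 1 (moment-identity).  The ballot formula
-- m·count m (r+1) = (r+1)·C((k+1)m + r, m−1) (ballot) turns each F into a binomial
-- coefficient; the division by n, n+1, n+2 in ℚ cancels the factor m.

open import Defs
open import Data.Nat using (ℕ; zero; suc; _+_; _*_; _∸_; _≤_; _<_; z≤n; s≤s; NonZero)
open import Data.Nat.Combinatorics using (_C_; nCk+nC[k+1]≡[n+1]C[k+1]; k>n⇒nCk≡0; nC1≡n)
open import Data.Integer using (+_)
open import Data.Rational using (_/_; toℚᵘ) renaming (_+_ to _+ℚ_; _-_ to _-ℚ_; -_ to -ℚ_)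
open import Relation.Binary.PropositionalEquality using (_≡_; refl; sym; trans; subst; cong; cong₂; module ≡-Reasoning)
import Data.Nat as ℕ
open import Data.Nat.Properties
  using (+-comm; +-suc; +-identityʳ; *-comm; *-zeroʳ; *-identityˡ; *-identityʳ; *-distribˡ-+; *-cancelˡ-≡; +-cancelʳ-≡;
         suc-injective; m≤n+m; m≤m*n; m≤n⇒∃[o]m+o≡n; m+n∸m≡n; m+n∸n≡m; ≤-trans; ≤-<-trans; n≮n)
open import Data.Nat.Tactic.RingSolver using (solve-∀)
open import Data.Nat.ListAction using (sum)
open import Data.Integer as ℤ using (ℤ; -_)
import Data.Integer.Properties as ℤP
open import Data.Integer.Tactic.RingSolver using () renaming (solve-∀ to ℤ-solve-∀)
open import Data.Rational.Properties using (toℚᵘ-injective; toℚᵘ-homo-+; toℚᵘ-homo‿-; toℚᵘ-fromℚᵘ; fromℚᵘ-cong)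
open import Data.Rational.Unnormalised as U using (ℚᵘ; mkℚᵘ; *≡*)
import Data.Rational.Unnormalised.Properties as UP
open import Data.Bool using (Bool; true; false; _∧_; if_then_else_)
open import Data.Bool.Properties using (T?)
open import Data.List using (List; []; _∷_; map; concatMap; filter; reverse; _++_)
open import Data.List.Properties using (map-cong; unfold-reverse)
open import Data.Product using (_,_)
open import Data.Empty using (⊥-elim; ⊥-elim-irr)
open import Relation.Nullary using (yes; no; ¬_)
open import Relation.Nullary.Decidable using (⌊_⌋)

pascal : ∀ n j → suc n C suc j ≡ n C j + n C suc j
pascal n j = sym (nCk+nC[k+1]≡[n+1]C[k+1] n j)

C-absorb : ∀ n j → suc j * (suc n C suc j) ≡ suc n * (n C j)
C-absorb zero    zero    = refl
C-absorb zero    (suc j) = begin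
    suc (suc j) * (1 C suc (suc j))  ≡⟨ cong (suc (suc j) *_) (k>n⇒nCk≡0 {1} {suc (suc j)} (s≤s (s≤s z≤n))) ⟩
    suc (suc j) * 0                  ≡⟨ *-zeroʳ (suc (suc j)) ⟩
    0                                ≡⟨ sym (k>n⇒nCk≡0 {0} {suc j} (s≤s z≤n)) ⟩
    0 C suc j                        ≡⟨ sym (*-identityˡ (0 C suc j)) ⟩
    1 * (0 C suc j)                  ∎
  where open ≡-Reasoning
C-absorb (suc n) zero    = begin
    1 * (suc (suc n) C 1)  ≡⟨ *-identityˡ _ ⟩
    suc (suc n) C 1        ≡⟨ nC1≡n (suc (suc n)) ⟩
    suc (suc n)            ≡⟨ sym (*-identityʳ (suc (suc n))) ⟩
    suc (suc n) * 1        ∎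
  where open ≡-Reasoning
C-absorb (suc n) (suc j) = begin
    suc (suc j) * (suc (suc n) C suc (suc j))
  ≡⟨ cong (suc (suc j) *_) (pascal (suc n) (suc j)) ⟩
    suc (suc j) * (X + Y)
  ≡⟨ split (suc j) X Y ⟩
    (suc j * X + X) + suc (suc j) * Y
  ≡⟨ cong₂ (λ a b → (a + X) + b) (C-absorb n j) (C-absorb n (suc j)) ⟩
    (suc n * (n C j) + X) + suc n * (n C suc j)
  ≡⟨ cong (λ z → (suc n * (n C j) + z) + suc n * (n C suc j)) (pascal n j) ⟩
    (suc n * (n C j) + (n C j + n C suc j)) + suc n * (n C suc j)
  ≡⟨ join (suc n) (n C j) (n C suc j) ⟩
    suc (suc n) * (n C j + n C suc j)
  ≡⟨ cong (suc (suc n) *_) (sym (pascal n j)) ⟩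
    suc (suc n) * X
  ∎
  where
  open ≡-Reasoning
  X Y : ℕ
  X = suc n C suc j
  Y = suc n C suc (suc j)
  split : ∀ a x y → suc a * (x + y) ≡ (a * x + x) + suc a * y
  split = solve-∀
  join : ∀ a p q → (a * p + (p + q)) + a * q ≡ suc a * (p + q)
  join = solve-∀

fall2 : ℕ → ℕ
fall2 e = e * (e ∸ 1)

module Walks (k : ℕ) where
  open ≡-Reasoning

  -- G ψ n r: the sum of ψ(room right after the last up-step) over all ways of doing n more
  -- up-steps from room r; a down-step into room 0 is forbidden, and with no up-steps left
  -- the current room is the one that counts.
  G : (ℕ → ℕ) → ℕ → ℕ → ℕ
  G ψ zero    r       = ψ r
  G ψ (suc n) zero    = 0
  G ψ (suc n) (suc r) = G ψ (suc n) r + G ψ n (suc r + k)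

  count : ℕ → ℕ → ℕ
  count = G (λ _ → 1)

  G-+ : ∀ ψ χ n r → G (λ x → ψ x + χ x) n r ≡ G ψ n r + G χ n r
  G-+ ψ χ zero    r       = refl
  G-+ ψ χ (suc n) zero    = refl
  G-+ ψ χ (suc n) (suc r) = begin
      G (λ x → ψ x + χ x) (suc n) r + G (λ x → ψ x + χ x) n (suc r + k)
    ≡⟨ cong₂ _+_ (G-+ ψ χ (suc n) r) (G-+ ψ χ n (suc r + k)) ⟩
      (G ψ (suc n) r + G χ (suc n) r) + (G ψ n (suc r + k) + G χ n (suc r + k))
    ≡⟨ interchange (G ψ (suc n) r) _ _ _ ⟩
      (G ψ (suc n) r + G ψ n (suc r + k)) + (G χ (suc n) r + G χ n (suc r + k))
    ∎
    where
    interchange : ∀ a b c d → (a + b) + (c + d) ≡ (a + c) + (b + d)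
    interchange = solve-∀

  G-* : ∀ c ψ n r → G (λ x → c * ψ x) n r ≡ c * G ψ n r
  G-* c ψ zero    r       = refl
  G-* c ψ (suc n) zero    = sym (*-zeroʳ c)
  G-* c ψ (suc n) (suc r) = begin
      G (λ x → c * ψ x) (suc n) r + G (λ x → c * ψ x) n (suc r + k)
    ≡⟨ cong₂ _+_ (G-* c ψ (suc n) r) (G-* c ψ n (suc r + k)) ⟩
      c * G ψ (suc n) r + c * G ψ n (suc r + k)
    ≡⟨ sym (*-distribˡ-+ c (G ψ (suc n) r) _) ⟩
      c * (G ψ (suc n) r + G ψ n (suc r + k))
    ∎

  G-shift : ∀ ψ j n r → G ψ (n + j) r ≡ G (G ψ j) n r
  G-shift ψ j zero    r       = refl
  G-shift ψ j (suc n) zero    = refl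
  G-shift ψ j (suc n) (suc r) = cong₂ _+_ (G-shift ψ j (suc n) r) (G-shift ψ j n (suc r + k))

  G-local : ∀ {ψ χ} → (∀ x → k < x → ψ x ≡ χ x) → ∀ n r → G ψ (suc n) r ≡ G χ (suc n) r
  G-local agree n       zero    = refl
  G-local agree zero    (suc r) = cong₂ _+_ (G-local agree zero r) (agree (suc r + k) (s≤s (m≤n+m k r)))
  G-local agree (suc n) (suc r) = cong₂ _+_ (G-local agree (suc n) r) (G-local agree n (suc r + k))

  count-1 : ∀ r → count 1 r ≡ r
  count-1 zero    = refl
  count-1 (suc r) = trans (cong (_+ 1) (count-1 r)) (+-comm r 1)

  count-2 : ∀ r → 2 * count 2 r + r ≡ r * r + 2 * suc k * r
  count-2 zero    = sym (*-zeroʳ (2 * suc k))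
  count-2 (suc r) = begin
      2 * (count 2 r + count 1 (suc r + k)) + suc r
    ≡⟨ cong (λ z → 2 * (count 2 r + z) + suc r) (count-1 (suc r + k)) ⟩
      2 * (count 2 r + (suc r + k)) + suc r
    ≡⟨ regroup (count 2 r) r k ⟩
      (2 * count 2 r + r) + (2 * r + 2 * k + 3)
    ≡⟨ cong (_+ (2 * r + 2 * k + 3)) (count-2 r) ⟩
      (r * r + 2 * suc k * r) + (2 * r + 2 * k + 3)
    ≡⟨ expand r k ⟩
      suc r * suc r + 2 * suc k * suc r
    ∎
    where
    regroup : ∀ f r k → 2 * (f + (suc r + k)) + suc r ≡ (2 * f + r) + (2 * r + 2 * k + 3)
    regroup = solve-∀
    expand : ∀ r k → (r * r + 2 * suc k * r) + (2 * r + 2 * k + 3) ≡ suc r * suc r + 2 * suc k * suc r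
    expand = solve-∀

  moment-base : ∀ t x → t < x →
    fall2 (x ∸ suc t) + 2 * (suc k + suc t) * count 1 x ≡ 2 * count 2 x + suc t * suc (suc t) * count 0 x
  moment-base t x t<x with m≤n⇒∃[o]m+o≡n t<x
  ... | d , refl = +-cancelʳ-≡ x _ _ (begin
      (fall2 (x ∸ s) + 2 * (suc k + s) * count 1 x) + x
    ≡⟨ cong₂ (λ e c → (fall2 e + 2 * (suc k + s) * c) + x) (m+n∸m≡n s d) (count-1 x) ⟩
      (fall2 d + 2 * (suc k + s) * x) + x
    ≡⟨ polynomial d ⟩
      (x * x + 2 * suc k * x) + s * suc s * 1
    ≡⟨ cong (_+ s * suc s * 1) (sym (count-2 x)) ⟩
      (2 * count 2 x + x) + s * suc s * 1
    ≡⟨ swap (2 * count 2 x) x (s * suc s * 1) ⟩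
      (2 * count 2 x + s * suc s * 1) + x
    ∎)
    where
    s : ℕ
    s = suc t
    swap : ∀ a b c → (a + b) + c ≡ (a + c) + b
    swap = solve-∀
    -- With x = s + d, both sides are the same polynomial in d (case split for the truncated d ∸ 1).
    polynomial : ∀ d → (fall2 d + 2 * (suc k + s) * (s + d)) + (s + d)
                       ≡ ((s + d) * (s + d) + 2 * suc k * (s + d)) + s * suc s * 1
    polynomial zero    = at-0 k t
      where
      at-0 : ∀ k t → (0 + 2 * (suc k + suc t) * (suc t + 0)) + (suc t + 0)
                     ≡ ((suc t + 0) * (suc t + 0) + 2 * suc k * (suc t + 0)) + suc t * suc (suc t) * 1
      at-0 = solve-∀
    polynomial (suc d) = at-suc k t d
      where
      at-suc : ∀ k t d → (suc d * d + 2 * (suc k + suc t) * (suc t + suc d)) + (suc t + suc d)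
                         ≡ ((suc t + suc d) * (suc t + suc d) + 2 * suc k * (suc t + suc d)) + suc t * suc (suc t) * 1
      at-suc = solve-∀

  moment-identity : ∀ t → t ≤ k → ∀ n r →
    G (λ x → fall2 (x ∸ suc t)) (suc n) r + 2 * (suc k + suc t) * count (suc n + 1) r
      ≡ 2 * count (suc n + 2) r + suc t * suc (suc t) * count (suc n) r
  moment-identity t t≤k n r = begin
      G w (suc n) r + c * count (suc n + 1) r
    ≡⟨ cong (λ z → G w (suc n) r + c * z) (G-shift (λ _ → 1) 1 (suc n) r) ⟩
      G w (suc n) r + c * G (count 1) (suc n) r
    ≡⟨ cong (λ z → G w (suc n) r + z) (sym (G-* c (count 1) (suc n) r)) ⟩
      G w (suc n) r + G (λ x → c * count 1 x) (suc n) r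
    ≡⟨ sym (G-+ w (λ x → c * count 1 x) (suc n) r) ⟩
      G (λ x → w x + c * count 1 x) (suc n) r
    ≡⟨ G-local (λ x k<x → moment-base t x (≤-<-trans t≤k k<x)) n r ⟩
      G (λ x → 2 * count 2 x + d * count 0 x) (suc n) r
    ≡⟨ G-+ (λ x → 2 * count 2 x) (λ x → d * count 0 x) (suc n) r ⟩
      G (λ x → 2 * count 2 x) (suc n) r + G (λ x → d * count 0 x) (suc n) r
    ≡⟨ cong₂ _+_ (G-* 2 (count 2) (suc n) r) (G-* d (count 0) (suc n) r) ⟩
      2 * G (count 2) (suc n) r + d * count (suc n) r
    ≡⟨ cong (λ z → 2 * z + d * count (suc n) r) (sym (G-shift (λ _ → 1) 2 (suc n) r)) ⟩
      2 * count (suc n + 2) r + d * count (suc n) r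
    ∎
    where
    w : ℕ → ℕ
    w x = fall2 (x ∸ suc t)
    c d : ℕ
    c = 2 * (suc k + suc t)
    d = suc t * suc (suc t)

  ballot-step : ∀ n r N → N ≡ suc k * suc n + r → count (suc n) (suc r) + k * (N C n) ≡ N C suc n
  ballot-step zero r N refl = begin
      count 1 (suc r) + k * 1  ≡⟨ cong (_+ k * 1) (count-1 (suc r)) ⟩
      suc r + k * 1            ≡⟨ rearrange k r ⟩
      suc k * 1 + r            ≡⟨ sym (nC1≡n (suc k * 1 + r)) ⟩
      (suc k * 1 + r) C 1      ∎
    where
    rearrange : ∀ k r → suc r + k * 1 ≡ suc k * 1 + r
    rearrange = solve-∀
  ballot-step (suc n) zero    zero     ()
  ballot-step (suc n) zero    (suc N′) eq = *-cancelˡ-≡ _ _ (suc (suc n)) (begin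
      suc (suc n) * ((0 + count (suc n) (suc k)) + k * (suc N′ C suc n))
    ≡⟨ cong (λ z → suc (suc n) * ((0 + count (suc n) (suc k)) + k * z)) (pascal N′ n) ⟩
      suc (suc n) * ((0 + count (suc n) (suc k)) + k * (N′ C n + N′ C suc n))
    ≡⟨ cong (λ z → suc (suc n) * z) (regroup (count (suc n) (suc k)) k (N′ C n) (N′ C suc n)) ⟩
      suc (suc n) * ((count (suc n) (suc k) + k * (N′ C n)) + k * (N′ C suc n))
    ≡⟨ cong (λ z → suc (suc n) * (z + k * (N′ C suc n))) (ballot-step n k N′ N′≡) ⟩
      suc (suc n) * (N′ C suc n + k * (N′ C suc n))
    ≡⟨ factor k n (N′ C suc n) ⟩
      suc (suc k * suc n + k) * (N′ C suc n)
    ≡⟨ cong (λ m → suc m * (N′ C suc n)) (sym N′≡) ⟩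
      suc N′ * (N′ C suc n)
    ≡⟨ sym (C-absorb N′ (suc n)) ⟩
      suc (suc n) * (suc N′ C suc (suc n))
    ∎)
    where
    N′≡ : N′ ≡ suc k * suc n + k
    N′≡ = suc-injective (trans eq (unfold k n))
      where
      unfold : ∀ k n → suc k * suc (suc n) + 0 ≡ suc (suc k * suc n + k)
      unfold = solve-∀
    regroup : ∀ f k x y → (0 + f) + k * (x + y) ≡ (f + k * x) + k * y
    regroup = solve-∀
    factor : ∀ k n y → suc (suc n) * (y + k * y) ≡ suc (suc k * suc n + k) * y
    factor = solve-∀
  ballot-step (suc n) (suc r) zero     ()
  ballot-step (suc n) (suc r) (suc N₀) eq = begin
      (count (suc (suc n)) (suc r) + count (suc n) (suc (suc r) + k)) + k * (suc N₀ C suc n)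
    ≡⟨ cong (λ z → (count (suc (suc n)) (suc r) + count (suc n) (suc (suc r) + k)) + k * z) (pascal N₀ n) ⟩
      (count (suc (suc n)) (suc r) + count (suc n) (suc (suc r) + k)) + k * (N₀ C n + N₀ C suc n)
    ≡⟨ regroup (count (suc (suc n)) (suc r)) (count (suc n) (suc (suc r) + k)) k (N₀ C n) (N₀ C suc n) ⟩
      (count (suc (suc n)) (suc r) + k * (N₀ C suc n)) + (count (suc n) (suc (suc r) + k) + k * (N₀ C n))
    ≡⟨ cong₂ _+_ (ballot-step (suc n) r N₀ N₀≡) (ballot-step n (suc r + k) N₀ (trans N₀≡ (shift k n r))) ⟩
      N₀ C suc (suc n) + N₀ C suc n
    ≡⟨ +-comm (N₀ C suc (suc n)) _ ⟩
      N₀ C suc n + N₀ C suc (suc n)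
    ≡⟨ sym (pascal N₀ (suc n)) ⟩
      suc N₀ C suc (suc n)
    ∎
    where
    N₀≡ : N₀ ≡ suc k * suc (suc n) + r
    N₀≡ = suc-injective (trans eq (unfold k n r))
      where
      unfold : ∀ k n r → suc k * suc (suc n) + suc r ≡ suc (suc k * suc (suc n) + r)
      unfold = solve-∀
    shift : ∀ k n r → suc k * suc (suc n) + r ≡ suc k * suc n + (suc r + k)
    shift = solve-∀
    regroup : ∀ f₁ f₂ k x y → (f₁ + f₂) + k * (x + y) ≡ (f₁ + k * y) + (f₂ + k * x)
    regroup = solve-∀

  ballot : ∀ n r → suc n * count (suc n) (suc r) ≡ suc r * ((suc k * suc n + r) C n)
  ballot n r = +-cancelʳ-≡ (suc n * k * X + suc n * X) _ _ (begin
      suc n * F + (suc n * k * X + suc n * X)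
    ≡⟨ collect (suc n) F k X ⟩
      suc n * (F + k * X) + suc n * X
    ≡⟨ cong (λ z → suc n * z + suc n * X) (ballot-step n r N refl) ⟩
      suc n * (N C suc n) + suc n * X
    ≡⟨ sym (*-distribˡ-+ (suc n) (N C suc n) X) ⟩
      suc n * (N C suc n + X)
    ≡⟨ cong (suc n *_) (trans (+-comm (N C suc n) X) (sym (pascal N n))) ⟩
      suc n * (suc N C suc n)
    ≡⟨ C-absorb N n ⟩
      suc N * X
    ≡⟨ expand k n r X ⟩
      suc r * X + (suc n * k * X + suc n * X)
    ∎)
    where
    N F X : ℕ
    N = suc k * suc n + r
    F = count (suc n) (suc r)
    X = N C n
    collect : ∀ m f k x → m * f + (m * k * x + m * x) ≡ m * (f + k * x) + m * x
    collect = solve-∀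
    expand : ∀ k n r x → suc (suc k * suc n + r) * x ≡ suc r * x + (suc n * k * x + suc n * x)
    expand = solve-∀

sumWords : (List Step → ℕ) → ℕ → ℕ
sumWords f L = sum (map f (words L))

sum-extend : ∀ f ws → sum (map f (concatMap (λ w → (U ∷ w) ∷ (D ∷ w) ∷ []) ws))
                      ≡ sum (map (λ w → f (U ∷ w)) ws) + sum (map (λ w → f (D ∷ w)) ws)
sum-extend f []       = refl
sum-extend f (w ∷ ws) = trans (cong (λ z → f (U ∷ w) + (f (D ∷ w) + z)) (sum-extend f ws))
                              (interchange (f (U ∷ w)) (f (D ∷ w)) _ _)
  where
  interchange : ∀ a b c d → a + (b + (c + d)) ≡ (a + c) + (b + d)
  interchange = solve-∀

sumWords-suc : ∀ f L → sumWords f (suc L) ≡ sumWords (λ w → f (U ∷ w)) L + sumWords (λ w → f (D ∷ w)) L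
sumWords-suc f L = sum-extend f (words L)

sumWords-cong : ∀ {f g} → (∀ w → f w ≡ g w) → ∀ L → sumWords f L ≡ sumWords g L
sumWords-cong f≗g L = cong sum (map-cong f≗g (words L))

sum-zeros : ∀ {A : Set} (xs : List A) → sum (map (λ _ → 0) xs) ≡ 0
sum-zeros []       = refl
sum-zeros (_ ∷ xs) = sum-zeros xs

sum-filter : ∀ {A : Set} (b : A → Bool) (g : A → ℕ) ws →
  sum (map g (filter (λ w → T? (b w)) ws)) ≡ sum (map (λ w → if b w then g w else 0) ws)
sum-filter b g []       = refl
sum-filter b g (w ∷ ws) with b w
... | true  = cong (λ z → g w + z) (sum-filter b g ws)
... | false = sum-filter b g ws

if-∧ : ∀ b c (x : ℕ) → (if b ∧ c then x else 0) ≡ (if b then (if c then x else 0) else 0)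
if-∧ true  c x = refl
if-∧ false c x = refl

ups-++ : ∀ v w → ups (v ++ w) ≡ ups v + ups w
ups-++ []      w = refl
ups-++ (U ∷ v) w = cong suc (ups-++ v w)
ups-++ (D ∷ v) w = ups-++ v w

ups-reverse : ∀ w → ups (reverse w) ≡ ups w
ups-reverse []      = refl
ups-reverse (U ∷ w) = begin
    ups (reverse (U ∷ w))      ≡⟨ cong ups (unfold-reverse U w) ⟩
    ups (reverse w ++ U ∷ [])  ≡⟨ ups-++ (reverse w) (U ∷ []) ⟩
    ups (reverse w) + 1        ≡⟨ +-comm (ups (reverse w)) 1 ⟩
    suc (ups (reverse w))      ≡⟨ cong suc (ups-reverse w) ⟩
    suc (ups w)                ∎
  where open ≡-Reasoning
ups-reverse (D ∷ w) = begin
    ups (reverse (D ∷ w))      ≡⟨ cong ups (unfold-reverse D w) ⟩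
    ups (reverse w ++ D ∷ [])  ≡⟨ ups-++ (reverse w) (D ∷ []) ⟩
    ups (reverse w) + 0        ≡⟨ +-identityʳ _ ⟩
    ups (reverse w)            ≡⟨ ups-reverse w ⟩
    ups w                      ∎
  where open ≡-Reasoning

trailingDs-U : ∀ v → trailingDs (v ++ U ∷ []) ≡ trailingDs v
trailingDs-U []      = refl
trailingDs-U (U ∷ v) = refl
trailingDs-U (D ∷ v) = cong suc (trailingDs-U v)

trailingDs-D : ∀ v m → ups v ≡ suc m → trailingDs (v ++ D ∷ []) ≡ trailingDs v
trailingDs-D (U ∷ v) m _     = refl
trailingDs-D (D ∷ v) m up≡ = cong suc (trailingDs-D v m up≡)

trailingDs-D-final : ∀ v → ups v ≡ 0 → trailingDs (v ++ D ∷ []) ≡ suc (trailingDs v)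
trailingDs-D-final []      _   = refl
trailingDs-D-final (D ∷ v) up≡ = cong suc (trailingDs-D-final v up≡)

e-U : ∀ w → e (U ∷ w) ≡ e w
e-U w = trans (cong trailingDs (unfold-reverse U w)) (trailingDs-U (reverse w))

e-D : ∀ w m → ups w ≡ suc m → e (D ∷ w) ≡ e w
e-D w m up≡ = trans (cong trailingDs (unfold-reverse D w)) (trailingDs-D (reverse w) m (trans (ups-reverse w) up≡))

e-D-final : ∀ w → ups w ≡ 0 → e (D ∷ w) ≡ suc (e w)
e-D-final w up≡ = trans (cong trailingDs (unfold-reverse D w)) (trailingDs-D-final (reverse w) (trans (ups-reverse w) up≡))

≟-suc : ∀ m n → ⌊ suc m ℕ.≟ suc n ⌋ ≡ ⌊ m ℕ.≟ n ⌋
≟-suc m n with m ℕ.≟ n | suc m ℕ.≟ suc n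
... | yes _   | yes _     = refl
... | no  _   | no  _     = refl
... | yes m≡n | no  sm≢sn = ⊥-elim (sm≢sn (cong suc m≡n))
... | no  m≢n | yes sm≡sn = ⊥-elim (m≢n (suc-injective sm≡sn))

module Paths (k t : ℕ) where
  open Walks k using (G)

  weight : (ℕ → ℕ) → ℕ → List Step → ℕ
  weight ψ u w = if ⌊ ups w ℕ.≟ u ⌋ then ψ (e w) else 0

  term : (ℕ → ℕ) → ℤ → ℕ → List Step → ℕ
  term ψ h u w = if validFrom k t h w then weight ψ u w else 0

  weight-U : ∀ ψ u w → weight ψ (suc u) (U ∷ w) ≡ weight ψ u w
  weight-U ψ u w = cong₂ (λ b x → if b then ψ x else 0) (≟-suc (ups w) u) (e-U w)

  weight-D : ∀ ψ u w → weight ψ (suc u) (D ∷ w) ≡ weight ψ (suc u) w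
  weight-D ψ u w with ups w ℕ.≟ suc u
  ... | yes up≡ = cong ψ (e-D w u up≡)
  ... | no  _   = refl

  weight-D-final : ∀ ψ w → weight ψ 0 (D ∷ w) ≡ weight (λ x → ψ (suc x)) 0 w
  weight-D-final ψ w with ups w ℕ.≟ 0
  ... | yes up≡ = cong ψ (e-D-final w up≡)
  ... | no  _   = refl

  term-U : ∀ ψ h u w → term ψ h (suc u) (U ∷ w) ≡ term ψ (h ℤ.+ + k) u w
  term-U ψ h u w = cong (λ x → if validFrom k t (h ℤ.+ + k) w then x else 0) (weight-U ψ u w)

  term-U-final : ∀ ψ h w → term ψ h 0 (U ∷ w) ≡ 0
  term-U-final ψ h w with validFrom k t (h ℤ.+ + k) w
  ... | true  = refl
  ... | false = refl

  term-D : ∀ ψ χ h u w → - + t ℤ.≤ h ℤ.- + 1 → weight ψ u (D ∷ w) ≡ weight χ u w →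
           term ψ h u (D ∷ w) ≡ term χ (h ℤ.- + 1) u w
  term-D ψ χ h u w inside same with - + t ℤ.≤? h ℤ.- + 1
  ... | yes _       = cong (λ x → if validFrom k t (h ℤ.- + 1) w then x else 0) same
  ... | no  outside = ⊥-elim (outside inside)

  term-D-blocked : ∀ ψ h u w → ¬ (- + t ℤ.≤ h ℤ.- + 1) → term ψ h u (D ∷ w) ≡ 0
  term-D-blocked ψ h u w outside with - + t ℤ.≤? h ℤ.- + 1
  ... | yes inside = ⊥-elim (outside inside)
  ... | no  _      = refl

  -- Heights written as a − t, where a ≥ 0 is the distance to the floor.
  height-up : ∀ {h} a → h ≡ + a ℤ.- + t → h ℤ.+ + k ≡ + (a + k) ℤ.- + t
  height-up a refl = trans (shuffle (+ a) (+ k) (+ t)) (cong (ℤ._- + t) (sym (ℤP.pos-+ a k)))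
    where
    shuffle : ∀ x y z → (x ℤ.- z) ℤ.+ y ≡ (x ℤ.+ y) ℤ.- z
    shuffle = ℤ-solve-∀

  height-down : ∀ {h} a → h ≡ + suc a ℤ.- + t → h ℤ.- + 1 ≡ + a ℤ.- + t
  height-down a refl = trans (cong (λ x → (x ℤ.- + t) ℤ.- + 1) (ℤP.pos-+ 1 a)) (cancel (+ a) (+ t))
    where
    cancel : ∀ x z → ((+ 1 ℤ.+ x) ℤ.- z) ℤ.- + 1 ≡ x ℤ.- z
    cancel = ℤ-solve-∀

  above-floor : ∀ a → - + t ℤ.≤ + a ℤ.- + t
  above-floor a = subst (- + t ℤ.≤_) (swap (+ a) (+ t)) (ℤP.i≤i+j (- + t) (+ a))
    where
    swap : ∀ x z → - z ℤ.+ x ≡ x ℤ.- z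
    swap = ℤ-solve-∀

  at-floor : ∀ {h} → h ≡ + 0 ℤ.- + t → ¬ (- + t ℤ.≤ h ℤ.- + 1)
  at-floor refl below = n≮n t (ℤP.drop‿+≤+ (ℤP.neg-cancel-≤ (subst (- + t ℤ.≤_) one-below below)))
    where
    step : ∀ z → (+ 0 ℤ.- z) ℤ.- + 1 ≡ - (+ 1 ℤ.+ z)
    step = ℤ-solve-∀
    one-below : (+ 0 ℤ.- + t) ℤ.- + 1 ≡ - + suc t
    one-below = trans (step (+ t)) (cong -_ (sym (ℤP.pos-+ 1 t)))

  -- After the last up-step: from height L, the only path suffix is L down-steps, with e = L.
  descent : ∀ L ψ h → h ≡ + (L + t) ℤ.- + t → sumWords (term ψ h 0) L ≡ ψ L
  descent zero    ψ h h≡ = at-zero h (trans h≡ (ℤP.+-inverseʳ (+ t)))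
    where
    at-zero : ∀ h → h ≡ + 0 → sumWords (term ψ h 0) 0 ≡ ψ 0
    at-zero .(+ 0) refl = +-identityʳ (ψ 0)
  descent (suc L) ψ h h≡ = begin
      sumWords (term ψ h 0) (suc L)
    ≡⟨ sumWords-suc (term ψ h 0) L ⟩
      sumWords (λ w → term ψ h 0 (U ∷ w)) L + sumWords (λ w → term ψ h 0 (D ∷ w)) L
    ≡⟨ cong₂ _+_ (trans (sumWords-cong (term-U-final ψ h) L) (sum-zeros (words L)))
                 (sumWords-cong (λ w → term-D ψ (λ x → ψ (suc x)) h 0 w inside (weight-D-final ψ w)) L) ⟩
      0 + sumWords (term (λ x → ψ (suc x)) (h ℤ.- + 1) 0) L
    ≡⟨ descent L (λ x → ψ (suc x)) (h ℤ.- + 1) (height-down (L + t) h≡) ⟩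
      ψ (suc L)
    ∎
    where
    open ≡-Reasoning
    inside : - + t ℤ.≤ h ℤ.- + 1
    inside = subst (- + t ℤ.≤_) (sym (height-down (L + t) h≡)) (above-floor (L + t))

  -- The path sum from height a − t with u up-steps to go is the walk sum G from room a + 1;
  -- the length L of the suffix is forced by the endpoint y = 0.
  pathSum-G : t ≤ k → ∀ L ψ a u h → h ≡ + a ℤ.- + t → L + t ≡ a + suc k * u →
              sumWords (term ψ h u) L ≡ G (λ x → ψ (x ∸ suc t)) u (suc a)
  pathSum-G t≤k L ψ a zero h h≡ len≡ = trans (descent L ψ h (subst (λ b → h ≡ + b ℤ.- + t) a≡ h≡)) (cong ψ L≡)
    where
    a≡ : a ≡ L + t
    a≡ = sym (trans len≡ (trans (cong (λ z → a + z) (*-zeroʳ (suc k))) (+-identityʳ a)))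
    L≡ : L ≡ a ∸ t
    L≡ = sym (trans (cong (_∸ t) a≡) (m+n∸n≡m L t))
  pathSum-G t≤k zero ψ a (suc u) h h≡ len≡ = ⊥-elim (n≮n k (≤-trans k<t t≤k))
    where
    k<t : suc k ≤ t
    k<t = subst (suc k ≤_) (sym len≡) (≤-trans (m≤m*n (suc k) (suc u)) (m≤n+m _ a))
  pathSum-G t≤k (suc L) ψ a (suc u) h h≡ len≡ = begin
      sumWords (term ψ h (suc u)) (suc L)
    ≡⟨ sumWords-suc (term ψ h (suc u)) L ⟩
      sumWords (λ w → term ψ h (suc u) (U ∷ w)) L + sumWords (λ w → term ψ h (suc u) (D ∷ w)) L
    ≡⟨ cong (_+ sumWords (λ w → term ψ h (suc u) (D ∷ w)) L) (sumWords-cong (term-U ψ h u) L) ⟩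
      sumWords (term ψ (h ℤ.+ + k) u) L + sumWords (λ w → term ψ h (suc u) (D ∷ w)) L
    ≡⟨ cong₂ _+_ (pathSum-G t≤k L ψ (a + k) u (h ℤ.+ + k) (height-up a h≡) (suc-injective (trans len≡ (unfold a k u))))
                 (down-part a h≡ len≡) ⟩
      G ψ′ u (suc (a + k)) + G ψ′ (suc u) a
    ≡⟨ +-comm (G ψ′ u (suc (a + k))) _ ⟩
      G ψ′ (suc u) a + G ψ′ u (suc a + k)
    ∎
    where
    open ≡-Reasoning
    ψ′ : ℕ → ℕ
    ψ′ x = ψ (x ∸ suc t)
    unfold : ∀ a k u → a + suc k * suc u ≡ suc ((a + k) + suc k * u)
    unfold = solve-∀
    down-part : ∀ a → h ≡ + a ℤ.- + t → suc L + t ≡ a + suc k * suc u →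
                sumWords (λ w → term ψ h (suc u) (D ∷ w)) L ≡ G ψ′ (suc u) a
    down-part zero     h≡ _    = trans (sumWords-cong (λ w → term-D-blocked ψ h (suc u) w (at-floor h≡)) L)
                                       (sum-zeros (words L))
    down-part (suc a′) h≡ len≡ = trans (sumWords-cong (λ w → term-D ψ ψ h (suc u) w inside (weight-D ψ u w)) L)
                                       (pathSum-G t≤k L ψ a′ (suc u) (h ℤ.- + 1) (height-down a′ h≡) (suc-injective len≡))
      where
      inside : - + t ℤ.≤ h ℤ.- + 1
      inside = subst (- + t ℤ.≤_) (sym (height-down a′ h≡)) (above-floor a′)

  coeffD2≡G : t ≤ k → ∀ n → coeffD2 k t n ≡ G (λ x → fall2 (x ∸ suc t)) n (suc t)
  coeffD2≡G t≤k n = begin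
      coeffD2 k t n
    ≡⟨ sum-filter (isPath k t n) (λ w → fall2 (e w)) (words ((k + 1) * n)) ⟩
      sum (map (λ w → if isPath k t n w then fall2 (e w) else 0) (words ((k + 1) * n)))
    ≡⟨ sumWords-cong (λ w → if-∧ (validFrom k t (+ 0) w) _ (fall2 (e w))) ((k + 1) * n) ⟩
      sumWords (term fall2 (+ 0) n) ((k + 1) * n)
    ≡⟨ pathSum-G t≤k ((k + 1) * n) fall2 t n (+ 0) (sym (ℤP.+-inverseʳ (+ t))) (length k n t) ⟩
      G (λ x → fall2 (x ∸ suc t)) n (suc t)
    ∎
    where
    open ≡-Reasoning
    length : ∀ k n t → (k + 1) * n + t ≡ t + suc k * n
    length = solve-∀

natᵘ : ℕ → ℚᵘ
natᵘ n = mkℚᵘ (+ n) 0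

cancel-denominator : ∀ d x .{{_ : NonZero d}} → (+ (d * x)) / d ≡ (+ x) / 1
cancel-denominator (suc d) x = fromℚᵘ-cong {mkℚᵘ (+ (suc d * x)) d} {natᵘ x} (*≡* (begin
    + (suc d * x) ℤ.* + 1  ≡⟨ ℤP.*-identityʳ (+ (suc d * x)) ⟩
    + (suc d * x)          ≡⟨ cong +_ (*-comm (suc d) x) ⟩
    + (x * suc d)          ≡⟨ ℤP.pos-* x (suc d) ⟩
    + x ℤ.* + suc d        ∎))
  where open ≡-Reasoning

-- A relation g + c = a + b in ℕ yields g = a + b − c in ℚ (checked in ℚᵘ, where it is ring arithmetic).
nat-difference : ∀ g a b c → g + c ≡ a + b → (+ g) / 1 ≡ ((+ a) / 1 +ℚ (+ b) / 1) -ℚ (+ c) / 1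
nat-difference g a b c g+c≡a+b = toℚᵘ-injective (begin
    toℚᵘ (+ g / 1)                                   ≈⟨ toℚᵘ-fromℚᵘ (natᵘ g) ⟩
    natᵘ g                                           ≈⟨ *≡* in-ℤ ⟩
    (natᵘ a U.+ natᵘ b) U.- natᵘ c                   ≈⟨ UP.+-cong (UP.+-cong (toℚᵘ-fromℚᵘ (natᵘ a)) (toℚᵘ-fromℚᵘ (natᵘ b)))
                                                                (UP.-‿cong (toℚᵘ-fromℚᵘ (natᵘ c))) ⟨
    (toℚᵘ (+ a / 1) U.+ toℚᵘ (+ b / 1)) U.- toℚᵘ (+ c / 1)
                                                     ≈⟨ UP.+-cong (toℚᵘ-homo-+ (+ a / 1) (+ b / 1)) (toℚᵘ-homo‿- (+ c / 1)) ⟨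
    toℚᵘ (+ a / 1 +ℚ + b / 1) U.+ toℚᵘ (-ℚ (+ c / 1)) ≈⟨ toℚᵘ-homo-+ (+ a / 1 +ℚ + b / 1) (-ℚ (+ c / 1)) ⟨
    toℚᵘ ((+ a / 1 +ℚ + b / 1) -ℚ + c / 1)            ∎)
  where
  open UP.≃-Reasoning
  move : ∀ x y z w → x ℤ.+ w ≡ y ℤ.+ z → x ℤ.* + 1 ≡ ((y ℤ.* + 1 ℤ.+ z ℤ.* + 1) ℤ.* + 1 ℤ.+ (- w) ℤ.* + 1) ℤ.* + 1
  move x y z w eq = trans (unit x w) (trans (cong (ℤ._- w) eq) (expand y z w))
    where
    unit : ∀ x w → x ℤ.* + 1 ≡ (x ℤ.+ w) ℤ.- w
    unit = ℤ-solve-∀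
    expand : ∀ y z w → (y ℤ.+ z) ℤ.- w ≡ ((y ℤ.* + 1 ℤ.+ z ℤ.* + 1) ℤ.* + 1 ℤ.+ (- w) ℤ.* + 1) ℤ.* + 1
    expand = ℤ-solve-∀
  in-ℤ : + g ℤ.* + 1 ≡ ((+ a ℤ.* + 1 ℤ.+ + b ℤ.* + 1) ℤ.* + 1 ℤ.+ (- + c) ℤ.* + 1) ℤ.* + 1
  in-ℤ = move (+ g) (+ a) (+ b) (+ c) (trans (sym (ℤP.pos-+ g c)) (trans (cong +_ g+c≡a+b) (ℤP.pos-+ a b)))

-- The terms of the theorem: by the ballot formula, c·(t+1)·C((k+1)e + t, j) / d is c·count e (t+1)
-- when e = d = j + 1 (the indices are taken as separate variables because the statement writes
-- j + 1 in several non-definitionally-equal ways).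
ballot-term : ∀ k t c j e d {num} .{{_ : NonZero d}} →
  num ≡ c * ((t + 1) * (((k + 1) * e + t) C j)) → e ≡ suc j → d ≡ suc j →
  (+ num) / d ≡ (+ (c * Walks.count k e (suc t))) / 1
ballot-term k t c j .(suc j) .(suc j) refl refl refl =
  trans (cong (λ z → (+ z) / suc j) scaled) (cancel-denominator (suc j) (c * count (suc j) (suc t)))
  where
  open Walks k using (count; ballot)
  open ≡-Reasoning
  swap : ∀ c m f → c * (m * f) ≡ m * (c * f)
  swap = solve-∀
  scaled : c * ((t + 1) * (((k + 1) * suc j + t) C j)) ≡ suc j * (c * count (suc j) (suc t))
  scaled = begin
      c * ((t + 1) * (((k + 1) * suc j + t) C j))
    ≡⟨ cong₂ (λ a b → c * (a * ((b * suc j + t) C j))) (+-comm t 1) (+-comm k 1) ⟩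
      c * (suc t * ((suc k * suc j + t) C j))
    ≡⟨ cong (c *_) (sym (ballot j t)) ⟩
      c * (suc j * count (suc j) (suc t))
    ≡⟨ swap c (suc j) (count (suc j) (suc t)) ⟩
      suc j * (c * count (suc j) (suc t))
    ∎

proposition5p4 : (k t : ℕ) → 1 ≤ k → t ≤ k → (n : ℕ) → .{{_ : NonZero n}} →
    (+ coeffD2 k t n) / 1 ≡
      ((+ (2 * (t + 1) * (((k + 1) * (n + 2) + t) C (n + 1)))) / suc (suc n)
        +ℚ (+ ((t + 1) * (t + 1) * (t + 2) * (((k + 1) * n + t) C (n ∸ 1)))) / n)
        -ℚ (+ (2 * (t + k + 2) * (t + 1) * (((k + 1) * (n + 1) + t) C n))) / suc n
proposition5p4 k t _ t≤k zero {{n≢0}} = ⊥-elim-irr (NonZero.nonZero n≢0)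
proposition5p4 k t _ t≤k (suc m) = begin
    (+ coeffD2 k t (suc m)) / 1
  ≡⟨ cong (λ z → (+ z) / 1) (Paths.coeffD2≡G k t t≤k (suc m)) ⟩
    (+ G (λ x → fall2 (x ∸ suc t)) (suc m) (suc t)) / 1
  ≡⟨ nat-difference (G (λ x → fall2 (x ∸ suc t)) (suc m) (suc t)) (2 * count (suc m + 2) (suc t)) (suc t * suc (suc t) * count (suc m) (suc t))
                    (2 * (suc k + suc t) * count (suc m + 1) (suc t)) (moment-identity t t≤k m (suc t)) ⟩
    ((+ (2 * count (suc m + 2) (suc t))) / 1 +ℚ (+ (suc t * suc (suc t) * count (suc m) (suc t))) / 1)
      -ℚ (+ (2 * (suc k + suc t) * count (suc m + 1) (suc t))) / 1
  ≡⟨ sym (cong₂ _-ℚ_ (cong₂ _+ℚ_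
       (ballot-term k t 2 (suc m + 1) (suc m + 2) (suc (suc (suc m))) (reassoc₁ t _) (cong suc (+-suc m 1)) (cong (λ z → suc (suc z)) (+-comm 1 m)))
       (ballot-term k t (suc t * suc (suc t)) m (suc m) (suc m) (reassoc₂ t _) refl refl))
       (ballot-term k t (2 * (suc k + suc t)) (suc m) (suc m + 1) (suc (suc m)) (reassoc₃ k t _) (cong suc (+-comm m 1)) refl)) ⟩
    ((+ (2 * (t + 1) * (((k + 1) * (suc m + 2) + t) C (suc m + 1)))) / suc (suc (suc m))
      +ℚ (+ ((t + 1) * (t + 1) * (t + 2) * (((k + 1) * suc m + t) C m))) / suc m)
      -ℚ (+ (2 * (t + k + 2) * (t + 1) * (((k + 1) * (suc m + 1) + t) C suc m))) / suc (suc m)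
  ∎
  where
  open Walks k using (G; count; moment-identity)
  open ≡-Reasoning
  reassoc₁ : ∀ t x → 2 * (t + 1) * x ≡ 2 * ((t + 1) * x)
  reassoc₁ = solve-∀
  reassoc₂ : ∀ t x → (t + 1) * (t + 1) * (t + 2) * x ≡ suc t * suc (suc t) * ((t + 1) * x)
  reassoc₂ = solve-∀
  reassoc₃ : ∀ k t x → 2 * (t + k + 2) * (t + 1) * x ≡ 2 * (suc k + suc t) * ((t + 1) * x)
  reassoc₃ = solve-∀
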